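{- Let $(G,+)$ be an abelian group, let $n\le m$ be positive integers with $m<\lceil\log_2 p(G)\rceil/2$, let $a\in G$ be nonzero and let $S\subseteq[m]_a$ with $|S|=n$. Then the rank-$n$ matroid $SM_m(a,S)$ is matched to itself if and only if $SM_m(a,S)$ is isomorphic to the uniform matroid $U_{n,m}$.
   Context: $p(G)$ is the smallest cardinality of a nonzero finite subgroup of $G$, with $p(G)=\infty$ if none exists. Under the condition on $m$ one fixes a total order $\preceq$ on $[2m]_a\cup\{0\}$ compatible with the group structure (for $x,y,z$ in the set, $x\preceq y$ implies $x+z\preceq y+z$ when these sums lie in the set). For positive integer $k$, $ka=a+\cdots+a$ ($k$ times) and $[k]_a=\{a,2a,\dots,ka\}$. Extended Schubert matroid: $SM_m(a,S)$ is the rank-$n$ matroid on $[m]_a$ whose bases are the $n$-subsets $T\subseteq[m]_a$ such that the $i$-th smallest element of $T$ does not exceed the $i$-th smallest element of $S$ for each $1\le i\le n$ (with respect to $\preceq$ when $a$ is positive; for negative $a$ the analogous counterpart, i.e. comparing $ka$ by the index $k$). Matchings: for matroids $M,N$ over $G$ (ground sets in $G$) of equal rank $n>0$, ordered bases $\{a_1,\dots,a_n\}$ of $M$ and $\{b_1,\dots,b_n\}$ of $N$ are matched if $a_i+b_i\notin E(M)$ for all $i$; $M$ is matched to $N$ if every basis of $M$ is matched to some basis of $N$. -}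

module Defs where

open import Level using (Level; _⊔_)
open import Algebra.Bundles using (AbelianGroup)
open import Data.Nat using (ℕ; zero; suc; _+_; _*_; _<_; _≤_)
open import Data.Nat.Logarithm using (⌈log₂_⌉)
open import Data.Fin using (Fin; toℕ)
import Data.Fin as F
open import Data.Fin.Subset using (Subset; _∈_; ∣_∣)
open import Data.Fin.Permutation using (Permutation′; _⟨$⟩ˡ_)
open import Data.Vec using (tabulate; lookup)
open import Data.List using (List; length; filter)
open import Data.List.Relation.Binary.Pointwise using (Pointwise)
open import Data.List.Base using ()
import Data.List.Relation.Unary.Unique.Setoid as UniqueS
import Data.List.Membership.Setoid as MemS
open import Data.Product using (Σ; ∃; _×_; _,_)
open import Function.Bundles using (_⇔_)
open import Function.Definitions using (Injective)
open import Relation.Binary.PropositionalEquality using (_≡_)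
open import Relation.Nullary using (¬_)
open import Data.Fin.Subset.Properties using (_∈?_)

module _ {c ℓ : Level} (G : AbelianGroup c ℓ) where
  open AbelianGroup G renaming (Carrier to A)
  open MemS setoid renaming (_∈_ to _∈ₗ_)

  _·_ : ℕ → A → A
  zero  · a = ε
  suc k · a = a ∙ (k · a)

  -- A nonzero finite subgroup of G, given by a duplicate-free list of
  -- its elements (its cardinality is the length of the list).
  record IsNonzeroFiniteSubgroup (H : List A) : Set (c ⊔ ℓ) where
    field
      distinct : UniqueS.Unique setoid H
      has-ε    : ε ∈ₗ H
      ∙-closed : ∀ {x y} → x ∈ₗ H → y ∈ₗ H → (x ∙ y) ∈ₗ H
      ⁻¹-closed : ∀ {x} → x ∈ₗ H → (x ⁻¹) ∈ₗ H
      nonzero  : ∃ λ x → x ∈ₗ H × ¬ (x ≈ ε)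

  -- The hypothesis  m < ⌈log₂ p(G)⌉ / 2  (vacuous if p(G) = ∞).
  -- Since ⌈log₂ -⌉ is monotone, ⌈log₂ p(G)⌉ is the minimum of
  -- ⌈log₂ |H|⌉ over nonzero finite subgroups H, and m < c/2 ⟺ 2m < c.
  LogCondition : ℕ → Set (c ⊔ ℓ)
  LogCondition m = ∀ (H : List A) → IsNonzeroFiniteSubgroup H →
                   2 * m < ⌈log₂ (length H) ⌉

record FinMatroid : Set₁ where
  field
    size    : ℕ
    IsBasis : Subset size → Set

open FinMatroid public

_⟦_⟧ : ∀ {e} → Permutation′ e → Subset e → Subset e
σ ⟦ T ⟧ = tabulate λ j → lookup T (σ ⟨$⟩ˡ j)

_≅_ : FinMatroid → FinMatroid → Set
M ≅ N = Σ (size M ≡ size N) λ { _≡_.refl →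
          Σ (Permutation′ (size M)) λ σ →
            ∀ T → IsBasis M T ⇔ IsBasis N (σ ⟦ T ⟧) }

U : ℕ → ℕ → FinMatroid
U n m = record { size = m ; IsBasis = λ T → ∣ T ∣ ≡ n }

sorted : ∀ {m} → Subset m → List (Fin m)
sorted {m} T = filter (_∈? T) (Data.List.allFin m)
  where import Data.List

Enumerates : ∀ {n e} → (Fin n → Fin e) → Subset e → Set
Enumerates f T = Injective _≡_ _≡_ f × (∀ k → (k ∈ T) ⇔ (∃ λ i → f i ≡ k))

module _ {c ℓ : Level} (G : AbelianGroup c ℓ) where
  open AbelianGroup G renaming (Carrier to A)

  -- The ground set [m]_a = {a, 2a, ..., ma}; index k : Fin m stands
  -- for the element (k+1)a.
  elt : ∀ {m} → A → Fin m → A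
  elt a k = _·_ G (suc (toℕ k)) a

  InGround : ℕ → A → A → Set ℓ
  InGround m a x = ∃ λ (k : Fin m) → x ≈ elt a k

  -- SM_m(a,S), S ⊆ [m]_a given by its index set.  A basis is an
  -- n-subset T (n = |S|) whose i-th smallest element does not exceed
  -- the i-th smallest element of S (elements ka compared by index k).
  SM : (m : ℕ) → A → Subset m → FinMatroid
  SM m a S = record
    { size = m
    ; IsBasis = λ T → ∣ T ∣ ≡ ∣ S ∣ × Pointwise F._≤_ (sorted T) (sorted S) }

  MatchedTo : (n : ℕ) → (a : A) (M : FinMatroid) → (b : A) (N : FinMatroid) → Set ℓ
  MatchedTo n a M b N =
    ∀ T → IsBasis M T →
      ∃ λ (T' : Subset (size N)) → IsBasis N T' ×
      ∃ λ (f : Fin n → Fin (size M)) → Enumerates f T ×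
      ∃ λ (g : Fin n → Fin (size N)) → Enumerates g T' ×
        (∀ i → ¬ (InGround (size M) a (elt a (f i) ∙ elt b (g i))))

{-# OPTIONS --safe #-}
module Submission where

-- Index k : Fin m stands for the element (k+1)a of [m]_a, so two ground elements with
-- indices i, j add up to (i+j+2)a, which lies outside [m]_a as soon as i + j + 2 > m.
-- The converse also holds because the multiples a, 2a, ..., 2ma are pairwise distinct:
-- if k a = 0 for some 0 < k ≤ 2m, then for the least such k the multiples
-- 0, a, ..., (k-1)a form a nonzero subgroup of order k, and ⌈log₂ k⌉ ≤ k ≤ 2m contradicts
-- the hypothesis on p(G).
--
-- If SM_m(a,S) is matched to itself, match the basis {0, ..., n-1} of smallest indices:
-- every partner index j of some i < n satisfies i + j + 2 > m, so the partner basis lies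
-- in the top n indices, and so does S, which dominates it.  Then every n-subset is a
-- basis.  Conversely, if SM_m(a,S) is uniform, the top n indices form a basis T', and
-- pairing the i-th smallest element of a basis T (index ≥ i) with the i-th largest
-- element of T' (index ≥ m-1-i) always gives sums beyond ma.

open import Defs hiding (_·_)
import Defs
open import Level using (Level)
open import Algebra.Bundles using (AbelianGroup)
open import Data.Nat
  using (ℕ; zero; suc; _+_; _*_; _∸_; _^_; _≤_; _<_; _≤′_; ≤′-refl; ≤′-step; z≤n; s≤s; s≤s⁻¹; z<s;
         NonZero; >-nonZero)
open import Data.Nat.Properties
open import Data.Nat.DivMod using (_%_; _/_; m≡m%n+[m/n]*n; m%n<n)
open import Data.Nat.Induction using (<-rec)
open import Data.Nat.Logarithm using (⌈log₂_⌉; ⌈log₂⌉-mono-≤; ⌈log₂2^n⌉≡n)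
open import Data.Bool using (true; false; if_then_else_)
open import Data.Fin as F using (Fin; zero; suc; toℕ; fromℕ<; opposite)
open import Data.Fin.Properties using (toℕ<n; toℕ-fromℕ<; opposite-prop)
import Data.Fin.Properties as Fin
open import Data.Fin.Subset using (Subset; inside; outside; _∈_; ∣_∣; ⊤) renaming (⊥ to ∅)
open import Data.Fin.Subset.Properties using (_∈?_; ∉⊥; ∣⊥∣≡0; ∣⊤∣≡n)
open import Data.Fin.Permutation as Perm using (Permutation′; _⟨$⟩ʳ_; _⟨$⟩ˡ_)
open import Data.Vec using ([]; _∷_; here; there)
import Data.Vec as Vec
open import Data.Vec.Properties using (lookup∘tabulate)
open import Data.List using (List; []; _∷_; length; filter; tabulate; lookup; allFin; applyUpTo)
open import Data.List.Properties using (length-applyUpTo)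
open import Data.List.Relation.Unary.All as All using (All; []; _∷_)
open import Data.List.Relation.Unary.AllPairs as AllPairs using (AllPairs; []; _∷_)
import Data.List.Relation.Unary.AllPairs.Properties as AllPairs
open import Data.List.Relation.Unary.Any using (index)
import Data.List.Relation.Unary.Any.Properties as Any
open import Data.List.Relation.Unary.Unique.Propositional using (Unique)
import Data.List.Relation.Unary.Unique.Setoid.Properties as UniqueSetoid
open import Data.List.Relation.Binary.Pointwise using (Pointwise; []; _∷_)
open import Data.List.Membership.Propositional renaming (_∈_ to _∈ₗ_)
open import Data.List.Membership.Propositional.Properties using (∈-lookup; ∈-filter⁺; ∈-filter⁻; ∈-allFin)
import Data.List.Membership.Setoid as SetoidMembership
open import Data.Product using (∃; _×_; _,_; proj₁; proj₂)
open import Data.Empty using (⊥-elim)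
open import Algebra.Properties.CommutativeMonoid.Sum +-0-commutativeMonoid using (sum; sum-cong-≗; sum-permute)
open import Function using (id; _∘_)
open import Function.Bundles using (_⇔_; mk⇔; Equivalence)
import Function.Properties.Equivalence as ⇔
open import Function.Definitions using (Injective)
open import Relation.Nullary using (¬_; does)
open import Relation.Binary.PropositionalEquality as ≡ using (_≡_; refl; cong)
import Relation.Binary.Reasoning.Setoid

private
  variable
    A : Set
    m n : ℕ

n<2^n : ∀ n → n < 2 ^ n
n<2^n zero    = z<s
n<2^n (suc n) = +-mono-≤ (m^n>0 2 n) (≤-trans (n<2^n n) (m≤m+n (2 ^ n) 0))

⌈log₂n⌉≤n : ∀ n → ⌈log₂ n ⌉ ≤ n
⌈log₂n⌉≤n n = ≤-trans (⌈log₂⌉-mono-≤ (<⇒≤ (n<2^n n))) (≤-reflexive (⌈log₂2^n⌉≡n n))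

module Multiples {c ℓ : Level} (G : AbelianGroup c ℓ) where
  open AbelianGroup G renaming (refl to ≈-refl)
  open import Algebra.Properties.Group group using (identityˡ-unique; inverseˡ-unique)
  module ≈-Reasoning = Relation.Binary.Reasoning.Setoid setoid
  open SetoidMembership setoid using () renaming (_∈_ to _∈ₛ_)

  infixr 8 _·_
  _·_ : ℕ → Carrier → Carrier
  _·_ = Defs._·_ G

  ·-homo-+ : ∀ p q x → (p + q) · x ≈ p · x ∙ q · x
  ·-homo-+ zero    q x = sym (identityˡ _)
  ·-homo-+ (suc p) q x = trans (∙-congˡ (·-homo-+ p q x)) (sym (assoc _ _ _))

  ·-cancelʳ : ∀ d q x → (d + q) · x ≈ q · x → d · x ≈ ε
  ·-cancelʳ d q x eq = identityˡ-unique (d · x) (q · x) (trans (sym (·-homo-+ d q x)) eq)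

  *-·≈ε : ∀ k {e x} → e · x ≈ ε → (k * e) · x ≈ ε
  *-·≈ε zero    e·x≈ε = ≈-refl
  *-·≈ε (suc k) {e} {x} e·x≈ε = begin
    (e + k * e) · x     ≈⟨ ·-homo-+ e (k * e) x ⟩
    e · x ∙ (k * e) · x ≈⟨ ∙-cong e·x≈ε (*-·≈ε k e·x≈ε) ⟩
    ε ∙ ε               ≈⟨ identityˡ ε ⟩
    ε                   ∎
    where open ≈-Reasoning

  ·≈%· : ∀ k {e} .{{_ : NonZero e}} {x} → e · x ≈ ε → k · x ≈ (k % e) · x
  ·≈%· k {e} {x} e·x≈ε = begin
    k · x                             ≡⟨ cong (_· x) (m≡m%n+[m/n]*n k e) ⟩
    (k % e + (k / e) * e) · x         ≈⟨ ·-homo-+ (k % e) ((k / e) * e) x ⟩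
    (k % e) · x ∙ ((k / e) * e) · x   ≈⟨ ∙-congˡ (*-·≈ε (k / e) e·x≈ε) ⟩
    (k % e) · x ∙ ε                   ≈⟨ identityʳ _ ⟩
    (k % e) · x                       ∎
    where open ≈-Reasoning

  module _ {x : Carrier} {e : ℕ} .{{_ : NonZero e}} (x≉ε : ¬ x ≈ ε) (e·x≈ε : e · x ≈ ε)
           (minimal : ∀ {j} → 0 < j → j < e → ¬ j · x ≈ ε) where

    private
      H : List Carrier
      H = applyUpTo (_· x) e

      ·-∈H : ∀ {y} k → y ≈ k · x → y ∈ₛ H
      ·-∈H k y≈k·x = Any.applyUpTo⁺ (_· x) (trans y≈k·x (·≈%· k e·x≈ε)) (m%n<n k e)

      distinct : ∀ {i j} → i < j → j < e → ¬ i · x ≈ j · x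
      distinct {i} {j} i<j j<e i·x≈j·x =
        minimal (m<n⇒0<n∸m i<j) (≤-<-trans (m∸n≤m j i) j<e)
          (·-cancelʳ (j ∸ i) i x (trans (reflexive (cong (_· x) (m∸n+n≡m (<⇒≤ i<j)))) (sym i·x≈j·x)))

      ∙-closed : ∀ {y z} → y ∈ₛ H → z ∈ₛ H → y ∙ z ∈ₛ H
      ∙-closed y∈H z∈H with Any.applyUpTo⁻ (_· x) y∈H | Any.applyUpTo⁻ (_· x) z∈H
      ... | i , _ , y≈i·x | j , _ , z≈j·x =
        ·-∈H (i + j) (trans (∙-cong y≈i·x z≈j·x) (sym (·-homo-+ i j x)))

      ⁻¹-closed : ∀ {y} → y ∈ₛ H → y ⁻¹ ∈ₛ H
      ⁻¹-closed y∈H with Any.applyUpTo⁻ (_· x) y∈H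
      ... | i , i<e , y≈i·x = ·-∈H (e ∸ i) (sym (trans (inverseˡ-unique _ _ (begin
        (e ∸ i) · x ∙ i · x ≈⟨ ·-homo-+ (e ∸ i) i x ⟨
        (e ∸ i + i) · x     ≡⟨ cong (_· x) (m∸n+n≡m (<⇒≤ i<e)) ⟩
        e · x               ≈⟨ e·x≈ε ⟩
        ε                   ∎)) (⁻¹-cong (sym y≈i·x))))
        where open ≈-Reasoning

    multiples-isNonzeroFiniteSubgroup : IsNonzeroFiniteSubgroup G (applyUpTo (_· x) e)
    multiples-isNonzeroFiniteSubgroup = record
      { distinct  = UniqueSetoid.applyUpTo⁺₁ setoid (_· x) e distinct
      ; has-ε     = ·-∈H 0 ≈-refl
      ; ∙-closed  = ∙-closed
      ; ⁻¹-closed = ⁻¹-closed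
      ; nonzero   = x , ·-∈H 1 (sym (identityʳ x)) , x≉ε
      }

  logCondition⇒·≉ε : LogCondition G m → ∀ {x} → ¬ x ≈ ε → ∀ d → 0 < d → d ≤ 2 * m → ¬ d · x ≈ ε
  logCondition⇒·≉ε {m} logCond {x} x≉ε = <-rec _ step
    where
    step : ∀ d → (∀ {j} → j < d → 0 < j → j ≤ 2 * m → ¬ j · x ≈ ε) →
           0 < d → d ≤ 2 * m → ¬ d · x ≈ ε
    step d smaller 0<d d≤2m d·x≈ε = <-irrefl ≡.refl (begin-strict
      2 * m                           <⟨ logCond _ (multiples-isNonzeroFiniteSubgroup x≉ε d·x≈ε minimal) ⟩
      ⌈log₂ length (applyUpTo _ d) ⌉  ≡⟨ cong ⌈log₂_⌉ (length-applyUpTo _ d) ⟩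
      ⌈log₂ d ⌉                       ≤⟨ ⌈log₂n⌉≤n d ⟩
      d                               ≤⟨ d≤2m ⟩
      2 * m                           ∎)
      where
      open ≤-Reasoning
      instance _ = >-nonZero 0<d
      minimal : ∀ {j} → 0 < j → j < d → ¬ j · x ≈ ε
      minimal 0<j j<d = smaller j<d 0<j (≤-trans (<⇒≤ j<d) d≤2m)

  logCondition⇒·-injective : LogCondition G m → ∀ {x} → ¬ x ≈ ε →
                             ∀ {p q} → q < p → p ≤ 2 * m → ¬ p · x ≈ q · x
  logCondition⇒·-injective {m} logCond x≉ε {p} {q} q<p p≤2m p·x≈q·x =
    logCondition⇒·≉ε {m} logCond x≉ε (p ∸ q) (m<n⇒0<n∸m q<p) (≤-trans (m∸n≤m p q) p≤2m)
      (·-cancelʳ (p ∸ q) q _ (trans (reflexive (cong (_· _) (m∸n+n≡m (<⇒≤ q<p)))) p·x≈q·x))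

lookup-injective : {xs : List A} → Unique xs → Injective _≡_ _≡_ (lookup xs)
lookup-injective {xs = _ ∷ _} _          {zero}  {zero}  _  = refl
lookup-injective              (x≢ ∷ _)   {zero}  {suc j} eq = ⊥-elim (All.lookup x≢ (∈-lookup j) eq)
lookup-injective              (x≢ ∷ _)   {suc i} {zero}  eq = ⊥-elim (All.lookup x≢ (∈-lookup i) (≡.sym eq))
lookup-injective              (_ ∷ uniq) {suc i} {suc j} eq = cong suc (lookup-injective uniq eq)

∈⇔∃lookup≡ : {xs : List A} {k : A} → k ∈ₗ xs ⇔ ∃ λ i → lookup xs i ≡ k
∈⇔∃lookup≡ = mk⇔ (λ k∈xs → index k∈xs , ≡.sym (Any.lookup-index k∈xs)) (λ { (i , refl) → ∈-lookup i })

head+length< : ∀ {c} {x : Fin m} {xs} → AllPairs F._<_ (x ∷ xs) → All (λ y → toℕ y < c) (x ∷ xs) →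
               toℕ x + length xs < c
head+length< {c = c} {x} {[]}     _                 (x<c ∷ []) = ≡.subst (_< c) (≡.sym (+-identityʳ (toℕ x))) x<c
head+length< {c = c} {x} {y ∷ xs} ((x<y ∷ _) ∷ xs↑) (_ ∷ xs<c) = begin-strict
  toℕ x + suc (length xs) ≡⟨ +-suc (toℕ x) (length xs) ⟩
  suc (toℕ x) + length xs ≤⟨ +-monoˡ-≤ (length xs) x<y ⟩
  toℕ y + length xs       <⟨ head+length< xs↑ xs<c ⟩
  c                       ∎
  where open ≤-Reasoning

-- The head of xs is at most b by head+length<, and the tails compare with b + 1.
increasing⇒pointwise-≤ : ∀ b {xs ys : List (Fin m)} → AllPairs F._<_ xs → AllPairs F._<_ ys →
                         length xs ≡ length ys → All (λ x → toℕ x < b + length xs) xs →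
                         All (λ y → b ≤ toℕ y) ys → Pointwise F._≤_ xs ys
increasing⇒pointwise-≤ b {[]}     {[]}     _ _ _ _ _ = []
increasing⇒pointwise-≤ b {x ∷ xs} {y ∷ ys} (x< ∷ xs↑) (y< ∷ ys↑) eq (x<b+ ∷ xs<b+) (b≤y ∷ _) =
  ≤-trans x≤b b≤y ∷ increasing⇒pointwise-≤ (suc b) xs↑ ys↑ (suc-injective eq)
                      (All.map (λ {z} → ≡.subst (toℕ z <_) (+-suc b (length xs))) xs<b+)
                      (All.map (≤-trans (s≤s b≤y)) y<)
  where
  x≤b : toℕ x ≤ b
  x≤b = +-cancelʳ-≤ (length xs) (toℕ x) b (s≤s⁻¹
          (≡.subst (toℕ x + length xs <_) (+-suc b (length xs)) (head+length< (x< ∷ xs↑) (x<b+ ∷ xs<b+))))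

lookup-≥ : ∀ b {xs : List (Fin m)} → AllPairs F._<_ xs → All (λ x → b ≤ toℕ x) xs →
           ∀ i → b + toℕ i ≤ toℕ (lookup xs i)
lookup-≥ b {x ∷ _}  _          (b≤x ∷ _) zero    = ≡.subst (_≤ toℕ x) (≡.sym (+-identityʳ b)) b≤x
lookup-≥ b {x ∷ xs} (x< ∷ xs↑) (b≤x ∷ _) (suc i) =
  ≡.subst (_≤ toℕ (lookup xs i)) (≡.sym (+-suc b (toℕ i)))
    (lookup-≥ (suc b) xs↑ (All.map (≤-trans (s≤s b≤x)) x<) i)

lookup-enumeration : ∀ b (xs : List (Fin m)) → length xs ≡ n → AllPairs F._<_ xs →
                     All (λ x → b ≤ toℕ x) xs →
                     ∃ λ (f : Fin n → Fin m) → Injective _≡_ _≡_ f × (∀ {k} → k ∈ₗ xs ⇔ ∃ λ i → f i ≡ k) ×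
                                               (∀ i → b + toℕ i ≤ toℕ (f i))
lookup-enumeration b xs refl xs↑ b≤xs =
  lookup xs , lookup-injective (AllPairs.map Fin.<⇒≢ xs↑) , ∈⇔∃lookup≡ , lookup-≥ b xs↑ b≤xs

pointwise-≤-lowerBound : ∀ {b} {xs ys : List (Fin m)} → Pointwise F._≤_ xs ys →
                         All (λ x → b ≤ toℕ x) xs → All (λ y → b ≤ toℕ y) ys
pointwise-≤-lowerBound []            []           = []
pointwise-≤-lowerBound (x≤y ∷ xs≤ys) (b≤x ∷ b≤xs) = ≤-trans b≤x x≤y ∷ pointwise-≤-lowerBound xs≤ys b≤xs

LowerBound : ℕ → Subset m → Set
LowerBound b T = ∀ {x} → x ∈ T → b ≤ toℕ x

sorted-increasing : (T : Subset m) → AllPairs F._<_ (sorted T)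
sorted-increasing T = AllPairs.filter⁺ (_∈? T) (AllPairs.tabulate⁺-< id)

∈ₗ-sorted⇔∈ : ∀ {T : Subset m} {k} → k ∈ₗ sorted T ⇔ k ∈ T
∈ₗ-sorted⇔∈ {m} {T} = mk⇔ (proj₂ ∘ ∈-filter⁻ (_∈? T) {xs = allFin m}) (∈-filter⁺ (_∈? T) (∈-allFin _))

private
  length-filter-∈?-∷ : ∀ {k} s (T : Subset m) (g : Fin k → Fin m) →
                       length (filter (_∈? (s ∷ T)) (tabulate (suc ∘ g))) ≡ length (filter (_∈? T) (tabulate g))
  length-filter-∈?-∷ {k = zero}  s T g = refl
  length-filter-∈?-∷ {k = suc k} s T g with does (g zero ∈? T)
  ... | true  = cong suc (length-filter-∈?-∷ s T (g ∘ suc))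
  ... | false = length-filter-∈?-∷ s T (g ∘ suc)

length-sorted : (T : Subset m) → length (sorted T) ≡ ∣ T ∣
length-sorted []            = refl
length-sorted (inside ∷ T)  = cong suc (≡.trans (length-filter-∈?-∷ inside T id) (length-sorted T))
length-sorted (outside ∷ T) = ≡.trans (length-filter-∈?-∷ outside T id) (length-sorted T)

sorted-pointwise-≤ : ∀ b {T S : Subset m} → ∣ T ∣ ≡ ∣ S ∣ → (∀ {x} → x ∈ T → toℕ x < b + ∣ T ∣) →
                     LowerBound b S → Pointwise F._≤_ (sorted T) (sorted S)
sorted-pointwise-≤ b {T} {S} ∣T∣≡∣S∣ T<b+∣T∣ b≤S =
  increasing⇒pointwise-≤ b (sorted-increasing T) (sorted-increasing S)
    (≡.trans (length-sorted T) (≡.trans ∣T∣≡∣S∣ (≡.sym (length-sorted S))))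
    (All.tabulate λ {x} x∈T →
      ≡.subst (λ k → toℕ x < b + k) (≡.sym (length-sorted T)) (T<b+∣T∣ (Equivalence.to ∈ₗ-sorted⇔∈ x∈T)))
    (All.tabulate (b≤S ∘ Equivalence.to ∈ₗ-sorted⇔∈))

sorted-pointwise-≤-lowerBound : ∀ {b} {T S : Subset m} → Pointwise F._≤_ (sorted T) (sorted S) →
                                LowerBound b T → LowerBound b S
sorted-pointwise-≤-lowerBound T≤S b≤T y∈S =
  All.lookup (pointwise-≤-lowerBound T≤S (All.tabulate (b≤T ∘ Equivalence.to ∈ₗ-sorted⇔∈)))
             (Equivalence.from ∈ₗ-sorted⇔∈ y∈S)

increasing-enumeration : ∀ b (T : Subset m) → ∣ T ∣ ≡ n → LowerBound b T →
                         ∃ λ (f : Fin n → Fin m) → Enumerates f T × (∀ i → b + toℕ i ≤ toℕ (f i))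
increasing-enumeration b T ∣T∣≡n b≤T
  with lookup-enumeration b (sorted T) (≡.trans (length-sorted T) ∣T∣≡n) (sorted-increasing T)
                          (All.tabulate (b≤T ∘ Equivalence.to ∈ₗ-sorted⇔∈))
... | f , f-injective , ∈⇔∃f≡ , b+i≤f = f , (f-injective , λ _ → ⇔.trans (⇔.sym ∈ₗ-sorted⇔∈) ∈⇔∃f≡) , b+i≤f

Enumerates-reindex : ∀ {f : Fin n → Fin m} {T} (π : Permutation′ n) → Enumerates f T →
                     Enumerates (f ∘ (π ⟨$⟩ʳ_)) T
Enumerates-reindex {f = f} π (f-injective , ∈⇔∃f≡) =
  (λ eq → ≡.trans (≡.sym (Perm.inverseˡ π)) (≡.trans (cong (π ⟨$⟩ˡ_) (f-injective eq)) (Perm.inverseˡ π))) ,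
  λ k → ⇔.trans (∈⇔∃f≡ k) (mk⇔ (λ { (i , refl) → π ⟨$⟩ˡ i , cong f (Perm.inverseʳ π) })
                                 (λ { (i , refl) → π ⟨$⟩ʳ i , refl }))

initial : n ≤ m → Subset m
initial z≤n       = ∅
initial (s≤s n≤m) = inside ∷ initial n≤m

∣initial∣≡n : (n≤m : n ≤ m) → ∣ initial n≤m ∣ ≡ n
∣initial∣≡n (z≤n {m}) = ∣⊥∣≡0 m
∣initial∣≡n (s≤s n≤m) = cong suc (∣initial∣≡n n≤m)

x∈initial⇒x<n : (n≤m : n ≤ m) → ∀ {x} → x ∈ initial n≤m → toℕ x < n
x∈initial⇒x<n z≤n       x∈∅         = ⊥-elim (∉⊥ x∈∅)
x∈initial⇒x<n (s≤s n≤m) here        = z<s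
x∈initial⇒x<n (s≤s n≤m) (there x∈I) = s≤s (x∈initial⇒x<n n≤m x∈I)

final : n ≤′ m → Subset m
final ≤′-refl        = ⊤
final (≤′-step n≤′m) = outside ∷ final n≤′m

∣final∣≡n : (n≤′m : n ≤′ m) → ∣ final n≤′m ∣ ≡ n
∣final∣≡n {n} ≤′-refl        = ∣⊤∣≡n n
∣final∣≡n     (≤′-step n≤′m) = ∣final∣≡n n≤′m

final-lowerBound : (n≤′m : n ≤′ m) → LowerBound (m ∸ n) (final n≤′m)
final-lowerBound {n} ≤′-refl        _           = ≤-trans (≤-reflexive (n∸n≡0 n)) z≤n
final-lowerBound     (≤′-step n≤′m) (there x∈F) =
  ≤-trans (≤-reflexive (+-∸-assoc 1 (≤′⇒≤ n≤′m))) (s≤s (final-lowerBound n≤′m x∈F))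

private
  indicator : Subset m → Fin m → ℕ
  indicator T i = if Vec.lookup T i then 1 else 0

  ∣T∣≡sum-indicator : (T : Subset m) → ∣ T ∣ ≡ sum (indicator T)
  ∣T∣≡sum-indicator []            = refl
  ∣T∣≡sum-indicator (inside ∷ T)  = cong suc (∣T∣≡sum-indicator T)
  ∣T∣≡sum-indicator (outside ∷ T) = ∣T∣≡sum-indicator T

∣σ⟦T⟧∣≡∣T∣ : (σ : Permutation′ m) (T : Subset m) → ∣ σ ⟦ T ⟧ ∣ ≡ ∣ T ∣
∣σ⟦T⟧∣≡∣T∣ σ T = begin
  ∣ σ ⟦ T ⟧ ∣                   ≡⟨ ∣T∣≡sum-indicator (σ ⟦ T ⟧) ⟩
  sum (indicator (σ ⟦ T ⟧))     ≡⟨ sum-cong-≗ (λ j → cong (λ s → if s then 1 else 0)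
                                     (lookup∘tabulate (Vec.lookup T ∘ (σ ⟨$⟩ˡ_)) j)) ⟩
  sum (indicator T ∘ (σ ⟨$⟩ˡ_)) ≡⟨ sum-permute (indicator T) (Perm.flip σ) ⟨
  sum (indicator T)             ≡⟨ ∣T∣≡sum-indicator T ⟨
  ∣ T ∣                         ∎
  where open ≡.≡-Reasoning

≅U⇒isBasis : (M : FinMatroid) → M ≅ U n (size M) → ∀ {T} → ∣ T ∣ ≡ n → IsBasis M T
≅U⇒isBasis M (refl , σ , bases) {T} ∣T∣≡n = Equivalence.from (bases T) (≡.trans (∣σ⟦T⟧∣≡∣T∣ σ T) ∣T∣≡n)

isBasis⇔card⇒≅U : (M : FinMatroid) → (∀ T → IsBasis M T ⇔ ∣ T ∣ ≡ n) → M ≅ U n (size M)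
isBasis⇔card⇒≅U M bases = refl , Perm.id , λ T →
  ⇔.trans (bases T) (mk⇔ (≡.trans (∣σ⟦T⟧∣≡∣T∣ Perm.id T)) (≡.trans (≡.sym (∣σ⟦T⟧∣≡∣T∣ Perm.id T))))

opposite-pairing : n ≤ m → (i : Fin n) → ∀ {x y} → toℕ i ≤ x → m ∸ n + toℕ (opposite i) ≤ y →
                   m < suc x + suc y
opposite-pairing {n} {m} n≤m i {x} {y} i≤x m∸n+i*≤y = begin-strict
  m                                           ≡⟨ m∸n+n≡m n≤m ⟨
  m ∸ n + n                                   ≡⟨ cong (m ∸ n +_) (m∸n+n≡m (toℕ<n i)) ⟨
  m ∸ n + (n ∸ suc (toℕ i) + suc (toℕ i))     ≡⟨ +-assoc (m ∸ n) _ _ ⟨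
  m ∸ n + (n ∸ suc (toℕ i)) + suc (toℕ i)     ≡⟨ cong (λ k → m ∸ n + k + suc (toℕ i)) (opposite-prop i) ⟨
  m ∸ n + toℕ (opposite i) + suc (toℕ i)      ≤⟨ +-mono-≤ m∸n+i*≤y (s≤s i≤x) ⟩
  y + suc x                                   ≡⟨ +-comm y (suc x) ⟩
  suc x + y                                   <⟨ +-monoʳ-< (suc x) (n<1+n y) ⟩
  suc x + suc y                               ∎
  where open ≤-Reasoning

module _ {c ℓ : Level} (G : AbelianGroup c ℓ) (a : AbelianGroup.Carrier G) where
  open AbelianGroup G using (_≈_; _∙_; ε; reflexive) renaming (sym to ≈-sym; trans to ≈-trans)
  open Multiples G

  elt-∙-elt : (i j : Fin m) → elt G a i ∙ elt G a j ≈ (suc (toℕ i) + suc (toℕ j)) · a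
  elt-∙-elt i j = ≈-sym (·-homo-+ (suc (toℕ i)) (suc (toℕ j)) a)

  elt-∙-inGround : (i j : Fin m) → suc (toℕ i) + suc (toℕ j) ≤ m → InGround G m a (elt G a i ∙ elt G a j)
  elt-∙-inGround i j i+j+2≤m =
    fromℕ< i+j+2≤m , ≈-trans (elt-∙-elt i j) (reflexive (cong (λ k → suc k · a) (≡.sym (toℕ-fromℕ< i+j+2≤m))))

  elt-∙-notInGround : LogCondition G m → ¬ a ≈ ε → (i j : Fin m) → m < suc (toℕ i) + suc (toℕ j) →
                      ¬ InGround G m a (elt G a i ∙ elt G a j)
  elt-∙-notInGround {m} logCond a≉ε i j m<i+j+2 (k , eq) =
    logCondition⇒·-injective {m} logCond a≉ε (≤-<-trans (toℕ<n k) m<i+j+2)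
      (≤-trans (+-mono-≤ (toℕ<n i) (toℕ<n j)) (≤-reflexive (cong (m +_) (≡.sym (+-identityʳ m)))))
      (≈-trans (≈-sym (elt-∙-elt i j)) eq)

  module _ {m : ℕ} {S : Subset m} where

    initial-isBasis : (n≤m : n ≤ m) → ∣ S ∣ ≡ n → IsBasis (SM G m a S) (initial n≤m)
    initial-isBasis n≤m ∣S∣≡n = ∣I∣≡∣S∣ , sorted-pointwise-≤ 0 ∣I∣≡∣S∣ I<∣I∣ (λ _ → z≤n)
      where
      ∣I∣≡∣S∣ : ∣ initial n≤m ∣ ≡ ∣ S ∣
      ∣I∣≡∣S∣ = ≡.trans (∣initial∣≡n n≤m) (≡.sym ∣S∣≡n)
      I<∣I∣ : ∀ {x} → x ∈ initial n≤m → toℕ x < ∣ initial n≤m ∣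
      I<∣I∣ {x} x∈I = ≡.subst (toℕ x <_) (≡.sym (∣initial∣≡n n≤m)) (x∈initial⇒x<n n≤m x∈I)

    matched⇒lowerBound : n ≤ m → ∣ S ∣ ≡ n → MatchedTo G n a (SM G m a S) a (SM G m a S) →
                         LowerBound (m ∸ n) S
    matched⇒lowerBound {n} n≤m ∣S∣≡n matched with matched (initial n≤m) (initial-isBasis n≤m ∣S∣≡n)
    ... | T , (_ , T≤S) , f , (_ , ∈I⇔∃f≡) , g , (_ , ∈T⇔∃g≡) , notInGround =
      sorted-pointwise-≤-lowerBound T≤S m∸n≤T
      where
      m∸n≤g : ∀ i → m ∸ n ≤ toℕ (g i)
      m∸n≤g i = m≤n+o⇒m∸n≤o m n (s≤s⁻¹ (begin-strict
        m                                <⟨ ≰⇒> (notInGround i ∘ elt-∙-inGround (f i) (g i)) ⟩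
        suc (toℕ (f i)) + suc (toℕ (g i)) ≤⟨ +-monoˡ-≤ _ (x∈initial⇒x<n n≤m (Equivalence.from (∈I⇔∃f≡ (f i)) (i , refl))) ⟩
        n + suc (toℕ (g i))              ≡⟨ +-suc n _ ⟩
        suc (n + toℕ (g i))              ∎))
        where open ≤-Reasoning
      m∸n≤T : LowerBound (m ∸ n) T
      m∸n≤T x∈T with Equivalence.to (∈T⇔∃g≡ _) x∈T
      ... | i , refl = m∸n≤g i

    lowerBound⇒≅U : n ≤ m → ∣ S ∣ ≡ n → LowerBound (m ∸ n) S → SM G m a S ≅ U n m
    lowerBound⇒≅U {n} n≤m ∣S∣≡n m∸n≤S = isBasis⇔card⇒≅U (SM G m a S) λ T →
      mk⇔ (λ T-isBasis → ≡.trans (proj₁ T-isBasis) ∣S∣≡n) (λ ∣T∣≡n → isBasis ∣T∣≡n)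
      where
      isBasis : ∀ {T} → ∣ T ∣ ≡ n → IsBasis (SM G m a S) T
      isBasis {T} ∣T∣≡n = ∣T∣≡∣S∣ , sorted-pointwise-≤ (m ∸ n) ∣T∣≡∣S∣ T<m m∸n≤S
        where
        ∣T∣≡∣S∣ : ∣ T ∣ ≡ ∣ S ∣
        ∣T∣≡∣S∣ = ≡.trans ∣T∣≡n (≡.sym ∣S∣≡n)
        T<m : ∀ {x} → x ∈ T → toℕ x < m ∸ n + ∣ T ∣
        T<m {x} _ = ≡.subst (toℕ x <_) (≡.sym (≡.trans (cong (m ∸ n +_) ∣T∣≡n) (m∸n+n≡m n≤m))) (toℕ<n x)

    final-isBasis⇒matched : LogCondition G m → ¬ a ≈ ε → (n≤′m : n ≤′ m) → ∣ S ∣ ≡ n →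
                            IsBasis (SM G m a S) (final n≤′m) → MatchedTo G n a (SM G m a S) a (SM G m a S)
    final-isBasis⇒matched {n} logCond a≉ε n≤′m ∣S∣≡n F-isBasis T (∣T∣≡∣S∣ , _)
      with increasing-enumeration 0 T (≡.trans ∣T∣≡∣S∣ ∣S∣≡n) (λ _ → z≤n)
         | increasing-enumeration (m ∸ n) (final n≤′m) (∣final∣≡n n≤′m) (final-lowerBound n≤′m)
    ... | f , f-enumerates , i≤f | e , e-enumerates , m∸n+j≤e =
      final n≤′m , F-isBasis , f , f-enumerates , e ∘ opposite , Enumerates-reindex Perm.reverse e-enumerates ,
      λ i → elt-∙-notInGround logCond a≉ε (f i) (e (opposite i))
              (opposite-pairing (≤′⇒≤ n≤′m) i (i≤f i) (m∸n+j≤e (opposite i)))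

corollary4p9 : ∀ {c ℓ : Level} (G : AbelianGroup c ℓ) (n m : ℕ) →
    0 < n → n ≤ m → LogCondition G m →
    (a : AbelianGroup.Carrier G) → ¬ (AbelianGroup._≈_ G a (AbelianGroup.ε G)) →
    (S : Subset m) → ∣ S ∣ ≡ n →
    MatchedTo G n a (SM G m a S) a (SM G m a S) ⇔ (SM G m a S ≅ U n m)
corollary4p9 G n m _ n≤m logCond a a≉ε S ∣S∣≡n = mk⇔
  (λ matched → lowerBound⇒≅U G a n≤m ∣S∣≡n (matched⇒lowerBound G a n≤m ∣S∣≡n matched))
  (λ SM≅U → final-isBasis⇒matched G a logCond a≉ε n≤′m ∣S∣≡n
              (≅U⇒isBasis (SM G m a S) SM≅U (∣final∣≡n n≤′m)))
  where
  n≤′m : n ≤′ m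
  n≤′m = ≤⇒≤′ n≤m
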